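{- Fix $n\ge 4$. If $H$ is a graph that contains no $K_4$ subgraph, has no $K_5$ minor, and admits a homomorphism $f:D_n\to H$, then $H$ contains an induced subgraph isomorphic to $D_m$ for some $m\ge 4$ with $m\mid n$.
   Context: Graphs are simple and undirected. For $n\ge 1$, $G_n$ is the graph with vertex set $\{v_1,v_2\}\cup\{a_i:i\in[n]\}\cup\{b_i:i\in[n]\}$ and edges $(v_1,a_i)$, $(v_2,b_i)$, $(a_i,b_i)$ for $i\in[n]$, and $(a_i,a_{i+1})$, $(b_i,b_{i+1})$, $(a_{i+1},b_i)$ for $i\in[n-1]$. $D_n$ is the graph on the same vertex set whose edges are those of $G_n$ together with $(a_1,a_n),(b_1,b_n),(a_1,b_n)$. -}

module Defs where

open import Data.Nat using (ℕ; zero; suc; _≤_)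
open import Data.Fin using (Fin; toℕ)
open import Data.Bool using (Bool; true; false)
open import Data.Maybe using (Maybe; just; nothing)
open import Data.Product using (Σ; _×_; _,_; ∃)
open import Data.Sum using (_⊎_)
open import Relation.Binary.PropositionalEquality using (_≡_; _≢_)
open import Function.Bundles using (_⇔_)

record Graph : Set where
  field
    N     : ℕ
    adj   : Fin N → Fin N → Bool
    sym   : ∀ u v → adj u v ≡ adj v u
    irref : ∀ u → adj u u ≡ false
open Graph public


-- Vertices of G_n / D_n.  a i (i : Fin n) stands for a_{toℕ i + 1}, same for b.
data DV (n : ℕ) : Set where
  v₁ v₂ : DV n
  a b   : Fin n → DV n

-- Edges of D_n (each listed once, in one orientation).
data DE (n : ℕ) : DV n → DV n → Set where
  v₁a  : ∀ i → DE n v₁ (a i)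
  v₂b  : ∀ i → DE n v₂ (b i)
  ab   : ∀ i → DE n (a i) (b i)
  aa   : ∀ i j → toℕ j ≡ suc (toℕ i) → DE n (a i) (a j)
  bb   : ∀ i j → toℕ j ≡ suc (toℕ i) → DE n (b i) (b j)
  ba   : ∀ i j → toℕ j ≡ suc (toℕ i) → DE n (a j) (b i)
  aaʷ  : ∀ i j → toℕ i ≡ 0 → suc (toℕ j) ≡ n → DE n (a i) (a j)
  bbʷ  : ∀ i j → toℕ i ≡ 0 → suc (toℕ j) ≡ n → DE n (b i) (b j)
  abʷ  : ∀ i j → toℕ i ≡ 0 → suc (toℕ j) ≡ n → DE n (a i) (b j)

DAdj : (n : ℕ) → DV n → DV n → Set
DAdj n x y = DE n x y ⊎ DE n y x

IsHom : (n : ℕ) (H : Graph) → (DV n → Fin (N H)) → Set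
IsHom n H f = ∀ x y → DE n x y → adj H (f x) (f y) ≡ true

HasInducedD : (m : ℕ) (H : Graph) → Set
HasInducedD m H = Σ (DV m → Fin (N H)) λ g →
  (∀ x y → g x ≡ g y → x ≡ y) ×
  (∀ x y → DAdj m x y ⇔ (adj H (g x) (g y) ≡ true))

HasK4 : Graph → Set
HasK4 H = Σ (Fin 4 → Fin (N H)) λ f →
  (∀ i j → f i ≡ f j → i ≡ j) × (∀ i j → i ≢ j → adj H (f i) (f j) ≡ true)

data WalkIn (H : Graph) (P : Fin (N H) → Set) : Fin (N H) → Fin (N H) → Set where
  here : ∀ {u} → WalkIn H P u u
  step : ∀ {u w v} → adj H u w ≡ true → P w → WalkIn H P w v → WalkIn H P u v

-- H has a K_5 minor: five pairwise disjoint, nonempty, connected branch sets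
-- (β v = just i means v lies in branch set i), pairwise joined by an edge.
HasK5Minor : Graph → Set
HasK5Minor H = Σ (Fin (N H) → Maybe (Fin 5)) λ β →
  (∀ i → ∃ λ v → β v ≡ just i) ×
  (∀ i u v → β u ≡ just i → β v ≡ just i → WalkIn H (λ w → β w ≡ just i) u v) ×
  (∀ i j → i ≢ j → Σ (Fin (N H)) λ u → Σ (Fin (N H)) λ v →
      β u ≡ just i × β v ≡ just j × adj H u v ≡ true)

{-# OPTIONS --safe #-}
-- Let x = f v₁, y = f v₂, and A k = f (a_k), B k = f (b_k) with indices mod n.  Every vertex of the closed
-- walk A is adjacent to x and to the connected set {y} ∪ B, so A is the rim of a wheel with two hubs, and so
-- is B.  K4-freeness keeps the hubs off the rims and forbids backtracking.  Without a K5 minor, a double wheel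
-- whose rim is a cycle has no chord, no vertex off it linking the two hubs, and no vertex off it that sees two
-- consecutive rim vertices and a third one.  From the first repetition on, this forces A to wind around an
-- induced cycle of some length p ≥ 4, so p ∣ n, and B around one of length q.  Each B j sees A j and A (1 + j),
-- hence no other vertex of the A-cycle; this gives p ∣ q, symmetrically q ∣ p, and pins down all edges between
-- the two cycles.  As also x ≁ y, the map v₁ ↦ x, v₂ ↦ y, a_i ↦ A i, b_i ↦ B i embeds D_p as an induced subgraph.
module Submission where

open import Defs renaming (sym to adj-sym)
open import Level using (0ℓ)
open import Data.Nat using (ℕ; zero; suc; _+_; _*_; _≤_; _<_; z≤n; s≤s; NonZero; >-nonZero; >-nonZero⁻¹; pred; _≤?_)
open import Data.Nat.Properties
open import Data.Nat.DivMod using (_%_; _/_; _mod_; m≡m%n+[m/n]*n; m%n<n; [m+n]%n≡m%n; [m+kn]%n≡m%n; m<n⇒m%n≡m; n%n≡0)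
open import Data.Nat.Divisibility using (_∣_; m%n≡0⇒n∣m; ∣-antisym)
open import Data.Nat.Induction using (<-wellFounded)
open import Induction.WellFounded using (Acc; acc)
open import Data.Fin using (Fin; toℕ)
open import Data.Fin.Patterns using (0F; 1F; 2F; 3F; 4F)
import Data.Fin.Properties as Fin
open import Data.Bool using (true)
open import Data.Empty using (⊥-elim)
open import Data.Maybe using (Maybe; just; nothing)
open import Data.Product using (Σ; ∃; _×_; _,_; proj₁)
open import Data.Sum using (_⊎_; inj₁; inj₂)
open import Function using (_∘_)
open import Function.Bundles using (mk⇔)
open import Relation.Nullary using (¬_; ¬?; yes; no; contradiction; _×-dec_)
open import Relation.Unary using (Pred; Decidable; _∪_; _∖_; _≬_; ｛_｝)
open import Relation.Unary.Properties using (_∪?_)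
open import Relation.Binary.PropositionalEquality
open import Relation.Binary.Definitions using (tri<; tri≈; tri>)
open import Algebra.Properties.CommutativeSemigroup +-commutativeSemigroup using (x∙yz≈xz∙y; xy∙z≈xz∙y; xy∙z≈y∙xz)

Periodic : {A : Set} → (ℕ → A) → ℕ → Set
Periodic c L = ∀ j → c (j + L) ≡ c j

module _ {A : Set} {c : ℕ → A} {L : ℕ} (periodic : Periodic c L) where

  periodic-+* : ∀ j q → c (j + q * L) ≡ c j
  periodic-+* j zero = cong c (+-identityʳ j)
  periodic-+* j (suc q) = trans (cong c (x∙yz≈xz∙y j L (q * L))) (trans (periodic (j + q * L)) (periodic-+* j q))

  periodic-% : .{{_ : NonZero L}} → ∀ j → c (j % L) ≡ c j
  periodic-% j = trans (sym (periodic-+* (j % L) (j / L))) (cong c (sym (m≡m%n+[m/n]*n j L)))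

  periodic-shift : ∀ k → Periodic (c ∘ (_+ k)) L
  periodic-shift k j = trans (cong c (xy∙z≈xz∙y j L k)) (periodic (j + k))

[1+m]%n≡[1+m%n]%n : ∀ m n .{{_ : NonZero n}} → suc m % n ≡ suc (m % n) % n
[1+m]%n≡[1+m%n]%n m n = trans (cong (λ k → suc k % n) (m≡m%n+[m/n]*n m n)) ([m+kn]%n≡m%n (suc (m % n)) (m / n) n)

%-step : ∀ m n .{{_ : NonZero n}} → suc m % n ≡ suc (m % n) ⊎ (suc m % n ≡ 0 × suc (m % n) ≡ n)
%-step m n with m≤n⇒m<n∨m≡n (m%n<n m n)
... | inj₁ 1+m%n<n = inj₁ (trans ([1+m]%n≡[1+m%n]%n m n) (m<n⇒m%n≡m 1+m%n<n))
... | inj₂ 1+m%n≡n = inj₂ (trans ([1+m]%n≡[1+m%n]%n m n) (trans (cong (_% n) 1+m%n≡n) (n%n≡0 n)) , 1+m%n≡n)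

periodic-wrap : {A : Set} {c : ℕ → A} {L : ℕ} → Periodic c L → ∀ {i j} → i ≡ 0 → suc j ≡ L → c (suc j) ≡ c i
periodic-wrap periodic refl refl = periodic 0

InjectiveBelow : {A : Set} → ℕ → (ℕ → A) → Set
InjectiveBelow L c = ∀ {x y} → x < L → y < L → c x ≡ c y → x ≡ y

injectiveBelow-mono : {A : Set} {c : ℕ → A} {K L : ℕ} → K ≤ L → InjectiveBelow L c → InjectiveBelow K c
injectiveBelow-mono K≤L inj x<K y<K = inj (<-≤-trans x<K K≤L) (<-≤-trans y<K K≤L)

module _ {ℓ} {P : Pred ℕ ℓ} (P? : Decidable P) where

  minimal-witness : ∀ {m} → P m → ∃ λ k → P k × (∀ {j} → j < k → ¬ P j)
  minimal-witness {m} = search m (<-wellFounded m)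
    where
    search : ∀ m → Acc _<_ m → P m → ∃ λ k → P k × (∀ {j} → j < k → ¬ P j)
    search m (acc below) pm with anyUpTo? P? m
    ... | yes (j , j<m , pj) = search j (below j<m) pj
    ... | no none = m , pm , λ j<m pj → none (_ , j<m , pj)

pairwise₅ : ∀ {ℓ} (R : Fin 5 → Fin 5 → Set ℓ) → (∀ {i j} → R i j → R j i) →
            R 0F 1F → R 0F 2F → R 0F 3F → R 0F 4F → R 1F 2F → R 1F 3F → R 1F 4F →
            R 2F 3F → R 2F 4F → R 3F 4F → ∀ i j → i ≢ j → R i j
pairwise₅ R symmetric r01 r02 r03 r04 r12 r13 r14 r23 r24 r34 = pair
  where
  pair : ∀ i j → i ≢ j → R i j
  pair 0F 1F _ = r01
  pair 0F 2F _ = r02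
  pair 0F 3F _ = r03
  pair 0F 4F _ = r04
  pair 1F 2F _ = r12
  pair 1F 3F _ = r13
  pair 1F 4F _ = r14
  pair 2F 3F _ = r23
  pair 2F 4F _ = r24
  pair 3F 4F _ = r34
  pair 1F 0F _ = symmetric r01
  pair 2F 0F _ = symmetric r02
  pair 3F 0F _ = symmetric r03
  pair 4F 0F _ = symmetric r04
  pair 2F 1F _ = symmetric r12
  pair 3F 1F _ = symmetric r13
  pair 4F 1F _ = symmetric r14
  pair 3F 2F _ = symmetric r23
  pair 4F 2F _ = symmetric r24
  pair 4F 3F _ = symmetric r34
  pair 0F 0F i≢i = contradiction refl i≢i
  pair 1F 1F i≢i = contradiction refl i≢i
  pair 2F 2F i≢i = contradiction refl i≢i
  pair 3F 3F i≢i = contradiction refl i≢i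
  pair 4F 4F i≢i = contradiction refl i≢i

module _ (H : Graph) where

  V : Set
  V = Fin (N H)

  infix 4 _~_
  _~_ : V → V → Set
  u ~ v = adj H u v ≡ true

  ~-sym : ∀ {u v} → u ~ v → v ~ u
  ~-sym {u} {v} u~v = trans (adj-sym H v u) u~v

  ~-irrefl : ∀ {u v} → u ~ v → u ≢ v
  ~-irrefl {u} u~u refl with trans (sym u~u) (irref H u)
  ... | ()

  Walk : Pred V 0ℓ → V → V → Set
  Walk = WalkIn H

  module _ {P : Pred V 0ℓ} where

    walk-map : ∀ {Q : Pred V 0ℓ} {u v} → (∀ {w} → P w → Q w) → Walk P u v → Walk Q u v
    walk-map P⊆Q here = here
    walk-map P⊆Q (step e p rest) = step e (P⊆Q p) (walk-map P⊆Q rest)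

    infixr 5 _◅◅_
    _◅◅_ : ∀ {u v w} → Walk P u v → Walk P v w → Walk P u w
    here ◅◅ q = q
    step e p rest ◅◅ q = step e p (rest ◅◅ q)

    walk-reverse : ∀ {u v} → P u → Walk P u v → Walk P v u
    walk-reverse pu here = here
    walk-reverse pu (step e p rest) = walk-reverse p rest ◅◅ step (~-sym e) pu here

  record ConnectedSet (P : Pred V 0ℓ) : Set where
    field
      member? : Decidable P
      root : V
      root∈ : P root
      walk-to-root : ∀ {u} → P u → Walk P u root

    walk : ∀ {u v} → P u → P v → Walk P u v
    walk pu pv = walk-to-root pu ◅◅ walk-reverse pv (walk-to-root pv)

  singleton : ∀ v → ConnectedSet ｛ v ｝
  singleton v = record
    { member? = v Fin.≟_ ; root = v ; root∈ = refl ; walk-to-root = λ { refl → here } }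

  extend : ∀ {P z v} → ConnectedSet P → P z → v ~ z → ConnectedSet (P ∪ ｛ v ｝)
  extend {P} {z} {v} C pz v~z = record
    { member? = member? ∪? (v Fin.≟_) ; root = root ; root∈ = inj₁ root∈ ; walk-to-root = to-root }
    where
    open ConnectedSet C
    to-root : ∀ {u} → (P ∪ ｛ v ｝) u → Walk (P ∪ ｛ v ｝) u root
    to-root (inj₁ pu) = walk-map inj₁ (walk-to-root pu)
    to-root (inj₂ refl) = step v~z (inj₁ pz) (walk-map inj₁ (walk-to-root pz))

  pair : ∀ {u v} → u ≡ v ⊎ u ~ v → ConnectedSet (｛ u ｝ ∪ ｛ v ｝)
  pair (inj₂ u~v) = extend (singleton _) refl (~-sym u~v)
  pair {u} (inj₁ refl) = record
    { member? = (u Fin.≟_) ∪? (u Fin.≟_) ; root = u ; root∈ = inj₁ refl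
    ; walk-to-root = λ { (inj₁ refl) → here ; (inj₂ refl) → here } }

  star : ∀ {P z} → Decidable P → P z → (∀ {u} → P u → z ≡ u ⊎ u ~ z) → ConnectedSet P
  star {P} {z} P? pz spoke = record
    { member? = P? ; root = z ; root∈ = pz ; walk-to-root = to-root }
    where
    to-root : ∀ {u} → P u → Walk P u z
    to-root pu with spoke pu
    ... | inj₁ refl = here
    ... | inj₂ u~z = step u~z pz here

  Arc : (ℕ → V) → ℕ → ℕ → Pred V 0ℓ
  Arc c k len v = Σ ℕ λ r → r < len × c (k + r) ≡ v

  arc? : ∀ c k len → Decidable (Arc c k len)
  arc? c k len v = anyUpTo? (λ r → c (k + r) Fin.≟ v) len

  arc : ∀ {c} → (∀ j → c j ~ c (suc j)) → ∀ k {len} → 0 < len → ConnectedSet (Arc c k len)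
  arc {c} path k {len} 0<len = record
    { member? = arc? c k len
    ; root = c (k + 0) ; root∈ = 0 , 0<len , refl ; walk-to-root = λ { (r , r<len , refl) → down r r<len } }
    where
    down : ∀ r → r < len → Walk (Arc c k len) (c (k + r)) (c (k + 0))
    down zero _ = here
    down (suc r) r+1<len = step back (r , <-trans (n<1+n r) r+1<len , refl) (down r (<-trans (n<1+n r) r+1<len))
      where
      back : c (k + suc r) ~ c (k + r)
      back = subst (λ i → c i ~ c (k + r)) (sym (+-suc k r)) (~-sym (path (k + r)))

  arc-periodic : ∀ {c n} → Periodic c n → .{{_ : NonZero n}} → ∀ k → Arc c 0 n (c k)
  arc-periodic {n = n} per k = k % n , m%n<n k n , periodic-% per k

  neighbour-avoiding : ∀ {P : Pred V 0ℓ} {u u′ v} w → u ~ u′ → P u → P u′ → u ~ v → u′ ~ v →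
                       Σ V λ z → (P ∖ ｛ w ｝) z × z ~ v
  neighbour-avoiding {u = u} {u′} w u~u′ pu pu′ u~v u′~v with w Fin.≟ u
  ... | no w≢u = u , (pu , w≢u) , u~v
  ... | yes refl = u′ , (pu′ , ~-irrefl u~u′) , u′~v

  Touch : Pred V 0ℓ → Pred V 0ℓ → Set
  Touch P Q = Σ V λ u → Σ V λ v → P u × Q v × u ~ v

  record K5Model : Set₁ where
    field
      S₀ S₁ S₂ S₃ S₄ : Pred V 0ℓ
      connected₀ : ConnectedSet S₀
      connected₁ : ConnectedSet S₁
      connected₂ : ConnectedSet S₂
      connected₃ : ConnectedSet S₃
      connected₄ : ConnectedSet S₄
      disjoint₀₁ : ¬ (S₀ ≬ S₁)
      disjoint₀₂ : ¬ (S₀ ≬ S₂)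
      disjoint₀₃ : ¬ (S₀ ≬ S₃)
      disjoint₀₄ : ¬ (S₀ ≬ S₄)
      disjoint₁₂ : ¬ (S₁ ≬ S₂)
      disjoint₁₃ : ¬ (S₁ ≬ S₃)
      disjoint₁₄ : ¬ (S₁ ≬ S₄)
      disjoint₂₃ : ¬ (S₂ ≬ S₃)
      disjoint₂₄ : ¬ (S₂ ≬ S₄)
      disjoint₃₄ : ¬ (S₃ ≬ S₄)
      touch₀₁ : Touch S₀ S₁
      touch₀₂ : Touch S₀ S₂
      touch₀₃ : Touch S₀ S₃
      touch₀₄ : Touch S₀ S₄
      touch₁₂ : Touch S₁ S₂
      touch₁₃ : Touch S₁ S₃
      touch₁₄ : Touch S₁ S₄
      touch₂₃ : Touch S₂ S₃
      touch₂₄ : Touch S₂ S₄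
      touch₃₄ : Touch S₃ S₄

    branch : Fin 5 → Pred V 0ℓ
    branch 0F = S₀
    branch 1F = S₁
    branch 2F = S₂
    branch 3F = S₃
    branch 4F = S₄

    connected : ∀ i → ConnectedSet (branch i)
    connected 0F = connected₀
    connected 1F = connected₁
    connected 2F = connected₂
    connected 3F = connected₃
    connected 4F = connected₄

    disjoint : ∀ i j → i ≢ j → ¬ (branch i ≬ branch j)
    disjoint = pairwise₅ (λ i j → ¬ (branch i ≬ branch j))
      (λ ¬overlap (v , p , q) → ¬overlap (v , q , p))
      disjoint₀₁ disjoint₀₂ disjoint₀₃ disjoint₀₄ disjoint₁₂ disjoint₁₃ disjoint₁₄ disjoint₂₃ disjoint₂₄ disjoint₃₄

    touch : ∀ i j → i ≢ j → Touch (branch i) (branch j)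
    touch = pairwise₅ (λ i j → Touch (branch i) (branch j))
      (λ (u , v , p , q , u~v) → v , u , q , p , ~-sym u~v)
      touch₀₁ touch₀₂ touch₀₃ touch₀₄ touch₁₂ touch₁₃ touch₁₄ touch₂₃ touch₂₄ touch₃₄

    label : V → Maybe (Fin 5)
    label v with Fin.any? (λ i → ConnectedSet.member? (connected i) v)
    ... | yes (i , _) = just i
    ... | no _ = nothing

    label-sound : ∀ {v i} → label v ≡ just i → branch i v
    label-sound {v} eq with Fin.any? (λ i → ConnectedSet.member? (connected i) v)
    label-sound refl | yes (_ , p) = p
    label-sound () | no _

    label-complete : ∀ {i v} → branch i v → label v ≡ just i
    label-complete {i} {v} p with Fin.any? (λ i → ConnectedSet.member? (connected i) v)
    ... | no none = contradiction (i , p) none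
    ... | yes (j , q) with j Fin.≟ i
    ...   | yes refl = refl
    ...   | no j≢i = contradiction (v , q , p) (disjoint j i j≢i)

    minor : HasK5Minor H
    minor = label
          , (λ i → root (connected i) , label-complete (root∈ (connected i)))
          , (λ i u v lu lv → walk-map (label-complete {i}) (walk (connected i) (label-sound lu) (label-sound lv)))
          , λ i j i≢j → let (u , v , p , q , u~v) = touch i j i≢j in
                        u , v , label-complete p , label-complete q , u~v
      where open ConnectedSet

  record DoubleWheel (h : V) (Z : Pred V 0ℓ) (c : ℕ → V) : Set where
    field
      Z-connected : ConnectedSet Z
      h∉Z : ¬ Z h
      c∉Z : ∀ r → ¬ Z (c r)
      h~c : ∀ r → h ~ c r
      Z~c : ∀ r → Σ V λ z → Z z × z ~ c r
      c~c : ∀ r → c r ~ c (suc r)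

    h≢c : ∀ r → h ≢ c r
    h≢c r = ~-irrefl (h~c r)

    shift : ∀ k → DoubleWheel h Z (c ∘ (_+ k))
    shift k = record
      { Z-connected = Z-connected ; h∉Z = h∉Z ; c∉Z = c∉Z ∘ (_+ k) ; h~c = h~c ∘ (_+ k)
      ; Z~c = Z~c ∘ (_+ k) ; c~c = c~c ∘ (_+ k) }

    -- For w = c 0 this is a chord; otherwise w is a vertex outside the wheel attached to c 0.
    chord⇒K5Minor : ∀ s → InjectiveBelow (4 + s) c →
                    ∀ w → c 0 ≡ w ⊎ c 0 ~ w → ¬ Z w → h ≢ w → (∀ r → 0 < r → r < 4 + s → c r ≢ w) →
                    w ~ c (2 + s) → HasK5Minor H
    chord⇒K5Minor s inj w c₀-w w∉Z h≢w off w~c = K5Model.minor model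
      where
      last<4+s : 3 + s < 4 + s
      last<4+s = n<1+n (3 + s)
      t<4+s : 2 + s < 4 + s
      t<4+s = n≤1+n (3 + s)
      inner< : ∀ {r} → r < 1 + s → 1 + r < 4 + s
      inner< r<1+s = s≤s (≤-trans r<1+s (m≤n+m (1 + s) 2))
      model : K5Model
      model = record
        { S₀ = ｛ h ｝
        ; S₁ = Z ∪ ｛ c (3 + s) ｝
        ; S₂ = ｛ c 0 ｝ ∪ ｛ w ｝
        ; S₃ = ｛ c (2 + s) ｝
        ; S₄ = Arc c 1 (1 + s)
        ; connected₀ = singleton h
        ; connected₁ = let (z , z∈Z , z~c) = Z~c (3 + s) in extend Z-connected z∈Z (~-sym z~c)
        ; connected₂ = pair c₀-w
        ; connected₃ = singleton (c (2 + s))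
        ; connected₄ = arc c~c 1 (s≤s z≤n)
        ; disjoint₀₁ = λ { (_ , refl , inj₁ h∈Z) → h∉Z h∈Z ; (_ , refl , inj₂ e) → h≢c _ (sym e) }
        ; disjoint₀₂ = λ { (_ , refl , inj₁ e) → h≢c 0 (sym e) ; (_ , refl , inj₂ e) → h≢w (sym e) }
        ; disjoint₀₃ = λ { (_ , refl , e) → h≢c _ (sym e) }
        ; disjoint₀₄ = λ { (_ , refl , _ , _ , e) → h≢c _ (sym e) }
        ; disjoint₁₂ = λ
            { (_ , inj₁ c₀∈Z , inj₁ refl) → c∉Z 0 c₀∈Z
            ; (_ , inj₁ w∈Z , inj₂ refl) → w∉Z w∈Z
            ; (_ , inj₂ refl , inj₁ e) → contradiction (inj (s≤s z≤n) last<4+s e) λ ()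
            ; (_ , inj₂ refl , inj₂ e) → off (3 + s) (s≤s z≤n) last<4+s (sym e) }
        ; disjoint₁₃ = λ
            { (_ , inj₁ ct∈Z , refl) → c∉Z _ ct∈Z
            ; (_ , inj₂ refl , e) → contradiction (inj last<4+s t<4+s (sym e)) 1+n≢n }
        ; disjoint₁₄ = λ
            { (_ , inj₁ cr∈Z , _ , _ , refl) → c∉Z _ cr∈Z
            ; (_ , inj₂ refl , r , r<1+s , e) →
                <-irrefl (inj (inner< r<1+s) last<4+s e) (m≤n⇒m≤1+n (s≤s r<1+s)) }
        ; disjoint₂₃ = λ
            { (_ , inj₁ refl , e) → contradiction (inj t<4+s (s≤s z≤n) e) λ ()
            ; (_ , inj₂ refl , e) → off (2 + s) (s≤s z≤n) t<4+s e }
        ; disjoint₂₄ = λ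
            { (_ , inj₁ refl , _ , r<1+s , e) → contradiction (inj (inner< r<1+s) (s≤s z≤n) e) λ ()
            ; (_ , inj₂ refl , r , r<1+s , e) → off (1 + r) (s≤s z≤n) (inner< r<1+s) e }
        ; disjoint₃₄ = λ { (_ , refl , r , r<1+s , e) → <-irrefl (cong pred (inj (inner< r<1+s) t<4+s e)) r<1+s }
        ; touch₀₁ = h , c (3 + s) , refl , inj₂ refl , h~c _
        ; touch₀₂ = h , c 0 , refl , inj₁ refl , h~c 0
        ; touch₀₃ = h , c (2 + s) , refl , refl , h~c _
        ; touch₀₄ = h , c 1 , refl , (0 , s≤s z≤n , refl) , h~c 1
        ; touch₁₂ = let (z , z∈Z , z~c) = Z~c 0 in z , c 0 , inj₁ z∈Z , inj₁ refl , z~c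
        ; touch₁₃ = c (3 + s) , c (2 + s) , inj₂ refl , refl , ~-sym (c~c _)
        ; touch₁₄ = let (z , z∈Z , z~c) = Z~c 1 in z , c 1 , inj₁ z∈Z , (0 , s≤s z≤n , refl) , z~c
        ; touch₂₃ = w , c (2 + s) , inj₂ refl , refl , w~c
        ; touch₂₄ = c 0 , c 1 , inj₁ refl , (0 , s≤s z≤n , refl) , c~c 0
        ; touch₃₄ = c (2 + s) , c (1 + s) , refl , (s , n<1+n s , refl) , ~-sym (c~c _)
        }

    -- For w = h the hub h touches Z directly.
    joined-hubs⇒K5Minor : ∀ s → InjectiveBelow (3 + s) c → c (2 + s) ~ c 0 →
                          ∀ w → h ≡ w ⊎ h ~ w → ¬ Z w → (∀ r → r < 3 + s → c r ≢ w) →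
                          ∀ z → Z z → w ~ z → HasK5Minor H
    joined-hubs⇒K5Minor s inj closing w h-w w∉Z off z z∈Z w~z = K5Model.minor model
      where
      0<3+s : 0 < 3 + s
      0<3+s = s≤s z≤n
      1<3+s : 1 < 3 + s
      1<3+s = s≤s (s≤s z≤n)
      model : K5Model
      model = record
        { S₀ = ｛ h ｝ ∪ ｛ w ｝
        ; S₁ = Z
        ; S₂ = ｛ c 0 ｝
        ; S₃ = ｛ c 1 ｝
        ; S₄ = Arc c 2 (1 + s)
        ; connected₀ = pair h-w
        ; connected₁ = Z-connected
        ; connected₂ = singleton (c 0)
        ; connected₃ = singleton (c 1)
        ; connected₄ = arc c~c 2 (s≤s z≤n)
        ; disjoint₀₁ = λ { (_ , inj₁ refl , h∈Z) → h∉Z h∈Z ; (_ , inj₂ refl , w∈Z) → w∉Z w∈Z }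
        ; disjoint₀₂ = λ { (_ , inj₁ refl , e) → h≢c 0 (sym e) ; (_ , inj₂ refl , e) → off 0 0<3+s e }
        ; disjoint₀₃ = λ { (_ , inj₁ refl , e) → h≢c 1 (sym e) ; (_ , inj₂ refl , e) → off 1 1<3+s e }
        ; disjoint₀₄ = λ
            { (_ , inj₁ refl , _ , _ , e) → h≢c _ (sym e)
            ; (_ , inj₂ refl , r , r<1+s , e) → off (2 + r) (s≤s (s≤s r<1+s)) e }
        ; disjoint₁₂ = λ { (_ , c₀∈Z , refl) → c∉Z 0 c₀∈Z }
        ; disjoint₁₃ = λ { (_ , c₁∈Z , refl) → c∉Z 1 c₁∈Z }
        ; disjoint₁₄ = λ { (_ , cr∈Z , _ , _ , refl) → c∉Z _ cr∈Z }
        ; disjoint₂₃ = λ { (_ , refl , e) → contradiction (inj 1<3+s 0<3+s e) λ () }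
        ; disjoint₂₄ = λ { (_ , refl , _ , r<1+s , e) → contradiction (inj (s≤s (s≤s r<1+s)) 0<3+s e) λ () }
        ; disjoint₃₄ = λ { (_ , refl , _ , r<1+s , e) → contradiction (inj (s≤s (s≤s r<1+s)) 1<3+s e) λ () }
        ; touch₀₁ = w , z , inj₂ refl , z∈Z , w~z
        ; touch₀₂ = h , c 0 , inj₁ refl , refl , h~c 0
        ; touch₀₃ = h , c 1 , inj₁ refl , refl , h~c 1
        ; touch₀₄ = h , c 2 , inj₁ refl , (0 , s≤s z≤n , refl) , h~c 2
        ; touch₁₂ = let (z , z∈Z , z~c) = Z~c 0 in z , c 0 , z∈Z , refl , z~c
        ; touch₁₃ = let (z , z∈Z , z~c) = Z~c 1 in z , c 1 , z∈Z , refl , z~c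
        ; touch₁₄ = let (z , z∈Z , z~c) = Z~c 2 in z , c 2 , z∈Z , (0 , s≤s z≤n , refl) , z~c
        ; touch₂₃ = c 0 , c 1 , refl , refl , c~c 0
        ; touch₂₄ = c 0 , c (2 + s) , refl , (s , n<1+n s , refl) , ~-sym closing
        ; touch₃₄ = c 1 , c 2 , refl , (0 , s≤s z≤n , refl) , c~c 1
        }

  record IsCycle (c : ℕ → V) (L : ℕ) : Set where
    field
      periodic : Periodic c L
      injective : ∀ k → InjectiveBelow L (c ∘ (_+ k))

    injective₀ : InjectiveBelow L c
    injective₀ x<L y<L e =
      injective 0 x<L y<L (trans (cong c (+-identityʳ _)) (trans e (cong c (sym (+-identityʳ _)))))

    shift : ∀ k → IsCycle (c ∘ (_+ k)) L
    shift k = record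
      { periodic = periodic-shift periodic k
      ; injective = λ m x<L y<L e →
          injective (m + k) x<L y<L (trans (cong c (sym (+-assoc _ m k))) (trans e (cong c (+-assoc _ m k)))) }

    return⇒∣ : .{{_ : NonZero L}} → ∀ {P} → c P ≡ c 0 → L ∣ P
    return⇒∣ {P} e = m%n≡0⇒n∣m P L (injective₀ (m%n<n P L) (>-nonZero⁻¹ L) (trans (periodic-% periodic P) e))

  Chordless : (ℕ → V) → ℕ → Set
  Chordless c L = ∀ k t → 2 ≤ t → 2 + t ≤ L → ¬ c k ~ c (t + k)

  chordless-neighbours : ∀ {c L} → Chordless c L → ∀ {i j} → i < j → j < L → c i ~ c j →
                         suc i ≡ j ⊎ (i ≡ 0 × suc j ≡ L)
  chordless-neighbours {c} {L} chordless {i} {j} i<j j<L ci~cj with m≤n⇒∃[o]m+o≡n i<j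
  ... | zero , refl = inj₁ (cong suc (sym (+-identityʳ i)))
  ... | suc o , refl with 4 + o ≤? L
  ...   | yes short = contradiction (subst (λ k → c i ~ c k) (cong suc (+-comm i (suc o))) ci~cj)
                                    (chordless i (2 + o) (s≤s (s≤s z≤n)) short)
  ...   | no long = inj₂ (i≡0 , ≤-antisym j<L (≤-trans L≤3+o (≤-reflexive 3+o≡suc-j)))
    where
    L≤3+o : L ≤ 3 + o
    L≤3+o = ≤-pred (≰⇒> long)
    i≡0 : i ≡ 0
    i≡0 = n≤0⇒n≡0 (+-cancelʳ-≤ (3 + o) i 0 (≤-trans (≤-reflexive suc-j) (≤-trans j<L L≤3+o)))
      where
      suc-j : i + (3 + o) ≡ suc (suc (i + suc o))
      suc-j = trans (+-suc i (2 + o)) (cong suc (+-suc i (suc o)))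
    3+o≡suc-j : 3 + o ≡ suc (suc (i + suc o))
    3+o≡suc-j rewrite i≡0 = refl

  chordless-adjacent : ∀ {c L} → Chordless c L → ∀ {i j} → i < L → j < L → c i ~ c j →
                       suc i ≡ j ⊎ suc j ≡ i ⊎ (i ≡ 0 × suc j ≡ L) ⊎ (j ≡ 0 × suc i ≡ L)
  chordless-adjacent chordless {i} {j} i<L j<L ci~cj with <-cmp i j
  ... | tri≈ _ refl _ = contradiction refl (~-irrefl ci~cj)
  ... | tri< i<j _ _ with chordless-neighbours chordless i<j j<L ci~cj
  ...   | inj₁ e = inj₁ e
  ...   | inj₂ wrap = inj₂ (inj₂ (inj₁ wrap))
  chordless-adjacent chordless {i} {j} i<L j<L ci~cj | tri> _ _ j<i
    with chordless-neighbours chordless j<i i<L (~-sym ci~cj)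
  ...   | inj₁ e = inj₂ (inj₁ e)
  ...   | inj₂ wrap = inj₂ (inj₂ (inj₂ wrap))

  chordless-shift : ∀ {c L} → Chordless c L → ∀ k → Chordless (c ∘ (_+ k)) L
  chordless-shift {c} chordless k m t 2≤t 2+t≤L chord =
    chordless (m + k) t 2≤t 2+t≤L (subst (λ j → c (m + k) ~ c j) (+-assoc t m k) chord)

  record InducedCycle (c : ℕ → V) (L : ℕ) : Set where
    field
      4≤length : 4 ≤ L
      cycle : IsCycle c L
      chordless : Chordless c L

  K4-from-edges : ∀ {p q r s} → p ~ q → p ~ r → p ~ s → q ~ r → q ~ s → r ~ s → HasK4 H
  K4-from-edges {p} {q} {r} {s} pq pr ps qr qs rs = vertex , injective , adjacent
    where
    vertex : Fin 4 → V
    vertex 0F = p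
    vertex 1F = q
    vertex 2F = r
    vertex 3F = s
    adjacent : ∀ i j → i ≢ j → vertex i ~ vertex j
    adjacent 0F 1F _ = pq
    adjacent 0F 2F _ = pr
    adjacent 0F 3F _ = ps
    adjacent 1F 2F _ = qr
    adjacent 1F 3F _ = qs
    adjacent 2F 3F _ = rs
    adjacent 1F 0F _ = ~-sym pq
    adjacent 2F 0F _ = ~-sym pr
    adjacent 3F 0F _ = ~-sym ps
    adjacent 2F 1F _ = ~-sym qr
    adjacent 3F 1F _ = ~-sym qs
    adjacent 3F 2F _ = ~-sym rs
    adjacent 0F 0F i≢i = contradiction refl i≢i
    adjacent 1F 1F i≢i = contradiction refl i≢i
    adjacent 2F 2F i≢i = contradiction refl i≢i
    adjacent 3F 3F i≢i = contradiction refl i≢i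
    injective : ∀ i j → vertex i ≡ vertex j → i ≡ j
    injective i j e with i Fin.≟ j
    ... | yes i≡j = i≡j
    ... | no i≢j = contradiction e (~-irrefl (adjacent i j i≢j))

  record Ladder (n : ℕ) : Set where
    field
      x y : V
      A B : ℕ → V
      A-periodic : Periodic A n
      B-periodic : Periodic B n
      x~A : ∀ k → x ~ A k
      y~B : ∀ k → y ~ B k
      A~A : ∀ k → A k ~ A (suc k)
      B~B : ∀ k → B k ~ B (suc k)
      A~B : ∀ k → A k ~ B k
      A⁺~B : ∀ k → A (suc k) ~ B k

    -- Shifting A by one step turns A⁺~B into the new A~B.
    swap : Ladder n
    swap = record
      { x = y ; y = x ; A = B ; B = A ∘ suc
      ; A-periodic = B-periodic ; B-periodic = A-periodic ∘ suc
      ; x~A = y~B ; y~B = x~A ∘ suc ; A~A = B~B ; B~B = A~A ∘ suc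
      ; A~B = ~-sym ∘ A⁺~B ; A⁺~B = ~-sym ∘ A~B ∘ suc }

  hom⇒ladder : ∀ n .{{_ : NonZero n}} (f : DV n → V) → IsHom n H f → Ladder n
  hom⇒ladder n f hom = record
    { x = f v₁ ; y = f v₂ ; A = f ∘ a ∘ position ; B = f ∘ b ∘ position
    ; A-periodic = cong (f ∘ a) ∘ position-periodic ; B-periodic = cong (f ∘ b) ∘ position-periodic
    ; x~A = λ k → hom _ _ (v₁a _) ; y~B = λ k → hom _ _ (v₂b _)
    ; A~A = A~A ; B~B = B~B ; A~B = λ k → hom _ _ (ab _) ; A⁺~B = A⁺~B }
    where
    position : ℕ → Fin n
    position k = k mod n
    toℕ-position : ∀ k → toℕ (position k) ≡ k % n
    toℕ-position k = Fin.toℕ-fromℕ< (m%n<n k n)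
    position-periodic : ∀ k → position (k + n) ≡ position k
    position-periodic k =
      Fin.toℕ-injective (trans (toℕ-position (k + n)) (trans ([m+n]%n≡m%n k n) (sym (toℕ-position k))))
    next-position : ∀ k → toℕ (position (suc k)) ≡ suc (toℕ (position k))
                        ⊎ (toℕ (position (suc k)) ≡ 0 × suc (toℕ (position k)) ≡ n)
    next-position k rewrite toℕ-position k | toℕ-position (suc k) = %-step k n
    A~A : ∀ k → f (a (position k)) ~ f (a (position (suc k)))
    A~A k with next-position k
    ... | inj₁ e = hom _ _ (aa _ _ e)
    ... | inj₂ (e₀ , eₙ) = ~-sym (hom _ _ (aaʷ _ _ e₀ eₙ))
    B~B : ∀ k → f (b (position k)) ~ f (b (position (suc k)))
    B~B k with next-position k
    ... | inj₁ e = hom _ _ (bb _ _ e)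
    ... | inj₂ (e₀ , eₙ) = ~-sym (hom _ _ (bbʷ _ _ e₀ eₙ))
    A⁺~B : ∀ k → f (a (position (suc k))) ~ f (b (position k))
    A⁺~B k with next-position k
    ... | inj₁ e = hom _ _ (ba _ _ e)
    ... | inj₂ (e₀ , eₙ) = hom _ _ (abʷ _ _ e₀ eₙ)

  module _ (noK4 : ¬ HasK4 H) (noK5 : ¬ HasK5Minor H) where

    module Outsider {h Z c L} (W : DoubleWheel h Z c) (C : IsCycle c L) (4≤L : 4 ≤ L)
                    {w} (w∉Z : ¬ Z w) (h≢w : h ≢ w) (off : ∀ r → c r ≢ w) (c₀~w : c 0 ~ w) (c₁~w : c 1 ~ w) where
      open IsCycle C using (periodic; injective; injective₀)

      private instance
        L-nonZero : NonZero L
        L-nonZero = >-nonZero (≤-trans (s≤s z≤n) 4≤L)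

      chord-from-c₀ : ∀ s → 4 + s ≤ L → ¬ w ~ c (2 + s)
      chord-from-c₀ s 4+s≤L = noK5 ∘ DoubleWheel.chord⇒K5Minor W s (injectiveBelow-mono 4+s≤L injective₀)
                                                               w (inj₂ c₀~w) w∉Z h≢w (λ r _ _ → off r)

      chord-from-c₁ : ∀ s → 4 + s ≤ L → ¬ w ~ c (3 + s)
      chord-from-c₁ s 4+s≤L w~c =
        noK5 (DoubleWheel.chord⇒K5Minor (DoubleWheel.shift W 1) s (injectiveBelow-mono 4+s≤L (injective 1))
                                        w (inj₂ c₁~w) w∉Z h≢w (λ r _ _ → off (r + 1))
                                        (subst (λ i → w ~ c (2 + i)) (sym (+-comm s 1)) w~c))

      neighbours : ∀ {r} → r < L → w ~ c r → r ≡ 0 ⊎ r ≡ 1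
      neighbours {0} _ _ = inj₁ refl
      neighbours {1} _ _ = inj₂ refl
      neighbours {2} _ w~c = contradiction w~c (chord-from-c₀ 0 4≤L)
      neighbours {suc (suc (suc s))} r<L w~c with 5 + s ≤? L
      ... | yes 5+s≤L = contradiction w~c (chord-from-c₀ (1 + s) 5+s≤L)
      ... | no _ = contradiction w~c (chord-from-c₁ s r<L)

      consecutive-neighbours⇒∣ : ∀ P → w ~ c P → w ~ c (suc P) → L ∣ P
      consecutive-neighbours⇒∣ P w~cP w~cP⁺
        with neighbours (m%n<n P L) (subst (w ~_) (sym (periodic-% periodic P)) w~cP)
      ... | inj₁ P%L≡0 = m%n≡0⇒n∣m P L P%L≡0
      ... | inj₂ P%L≡1 = contradiction (neighbours (≤-trans (n≤1+n 3) 4≤L) w~c₂) λ { (inj₁ ()) ; (inj₂ ()) }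
        where
        w~c₂ : w ~ c 2
        w~c₂ = subst (λ i → w ~ c (suc i)) P%L≡1
                     (subst (w ~_) (sym (periodic-% {c = c ∘ suc} (periodic ∘ suc) P)) w~cP⁺)

    module ClosedWalk {h Z S n} (W : DoubleWheel h Z S) (periodic : Periodic S n) .{{_ : NonZero n}}
                      (no-backtrack : ∀ j → S (2 + j) ≢ S j) where
      open DoubleWheel W using (h~c; c~c; c∉Z; Z~c; h≢c)

      Return : Pred ℕ 0ℓ
      Return d = ∃ λ i → i < n × S i ≡ S (suc d + i)

      return? : Decidable Return
      return? d = anyUpTo? (λ i → S i Fin.≟ S (suc d + i)) n

      return-after-period : Return (pred n)
      return-after-period =
        0 , >-nonZero⁻¹ n , sym (trans (cong S (trans (+-identityʳ _) (suc-pred n))) (periodic 0))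

      no-short-return : ∀ {i d} → S i ≡ S (suc d + i) → 3 ≤ d
      no-short-return {i} {0} e = contradiction e (~-irrefl (c~c i))
      no-short-return {i} {1} e = contradiction (sym e) (no-backtrack i)
      no-short-return {i} {2} e =
        ⊥-elim (noK4 (K4-from-edges (h~c i) (h~c (1 + i)) (h~c (2 + i)) (c~c i) S₀~S₂ (c~c (1 + i))))
        where
        S₀~S₂ : S i ~ S (2 + i)
        S₀~S₂ = ~-sym (subst (S (2 + i) ~_) (sym e) (c~c (2 + i)))
      no-short-return {d = suc (suc (suc _))} _ = s≤s (s≤s (s≤s z≤n))

      module FirstReturn (s i : ℕ) (i<n : i < n) (closes : S i ≡ S (4 + s + i))
                     (minimal : ∀ {d} → d < 3 + s → ¬ Return d) where
        L : ℕ
        L = 4 + s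

        no-early-return : ∀ j {d} → d < 3 + s → S j ≢ S (suc d + j)
        no-early-return j {d} d<3+s e =
          minimal d<3+s (j % n , m%n<n j n , trans (periodic-% periodic j) (trans e (sym (periodic-% shifted j))))
          where
          shifted : Periodic (S ∘ (suc d +_)) n
          shifted k = trans (cong S (sym (+-assoc (suc d) k n))) (periodic (suc d + k))

        no-repeat-within : ∀ k {x y} → x < y → y < L → S (x + k) ≢ S (y + k)
        no-repeat-within k {x} x<y y<L e with m≤n⇒∃[o]m+o≡n x<y
        ... | o , refl =
          no-early-return (x + k) (≤-<-trans (m≤n+m o x) (≤-pred y<L)) (trans e (cong (S ∘ suc) (xy∙z≈y∙xz x o k)))

        window-injective : ∀ k → InjectiveBelow L (S ∘ (_+ k))
        window-injective k {x} {y} x<L y<L e with <-cmp x y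
        ... | tri< x<y _ _ = contradiction e (no-repeat-within k x<y y<L)
        ... | tri≈ _ x≡y _ = x≡y
        ... | tri> _ _ y<x = contradiction (sym e) (no-repeat-within k y<x x<L)

        chordless : Chordless S L
        chordless k 0 () _
        chordless k 1 (s≤s ()) _
        chordless k (suc (suc t)) _ 4+t≤L chord =
          noK5 (DoubleWheel.chord⇒K5Minor (DoubleWheel.shift W k) t (injectiveBelow-mono 4+t≤L (window-injective k))
                                          (S k) (inj₁ refl) (c∉Z k) (h≢c k) off chord)
          where
          off : ∀ r → 0 < r → r < 4 + t → S (r + k) ≢ S k
          off r 0<r r<4+t e = <⇒≢ 0<r (sym (window-injective k (≤-trans r<4+t 4+t≤L) (s≤s z≤n) e))

        on-window : ∀ k → S (L + k) ≡ S k → ∀ j → ∃ λ r → r < L × S (r + k) ≡ S j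
        on-window k closes-at-k j with anyUpTo? (λ r → S (r + k) Fin.≟ S j) L
        ... | yes found = found
        ... | no none = let (z , z∈Z , z~Sj) = Z~c j in
          ⊥-elim (noK5 (DoubleWheel.joined-hubs⇒K5Minor (DoubleWheel.shift W k) (1 + s) (window-injective k) closing
                                                        (S j) (inj₂ (h~c j)) (c∉Z j) (λ r r<L e → none (r , r<L , e))
                                                        z z∈Z (~-sym z~Sj)))
          where
          closing : S (3 + s + k) ~ S k
          closing = subst (S (3 + s + k) ~_) closes-at-k (c~c (3 + s + k))

        closing-edge : ∀ k → S (L + k) ≡ S k → S k ~ S (suc (L + k))
        closing-edge k closes-at-k = subst (_~ S (suc (L + k))) closes-at-k (c~c (L + k))

        -- The vertex after S (L + k) = S k lies on the window (on-window) and is a neighbour of S k other than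
        -- its predecessor S (3 + s + k) (no backtracking); as the cycle is chordless, it is S (1 + k).
        closes-next : ∀ k → S (L + k) ≡ S k → S (L + suc k) ≡ S (suc k)
        closes-next k closes-at-k with on-window k closes-at-k (suc (L + k))
        ... | 0 , _ , e = contradiction e (~-irrefl (closing-edge k closes-at-k))
        ... | suc r , r<L , e
          with chordless-neighbours (chordless-shift chordless k) (s≤s z≤n) r<L
                                    (subst (S k ~_) (sym e) (closing-edge k closes-at-k))
        ...   | inj₁ refl = trans (cong S (+-suc L k)) (sym e)
        ...   | inj₂ (_ , refl) = contradiction (sym e) (no-backtrack (3 + s + k))

        closes-from-start : ∀ r → S (L + (r + i)) ≡ S (r + i)
        closes-from-start zero = sym closes
        closes-from-start (suc r) = closes-next (r + i) (closes-from-start r)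

        periodic-L : Periodic S L
        periodic-L j with m≤n⇒∃[o]m+o≡n (≤-trans (<⇒≤ i<n) (m≤n+m n j))
        ... | r , i+r≡j+n = begin
          S (j + L)       ≡⟨ periodic (j + L) ⟨
          S (j + L + n)   ≡⟨ cong S (trans (xy∙z≈y∙xz j L n) (cong (L +_) (trans (sym i+r≡j+n) (+-comm i r)))) ⟩
          S (L + (r + i)) ≡⟨ closes-from-start r ⟩
          S (r + i)       ≡⟨ cong S (trans (+-comm r i) i+r≡j+n) ⟩
          S (j + n)       ≡⟨ periodic j ⟩
          S j             ∎
          where open ≡-Reasoning

        cycle : IsCycle S L
        cycle = record { periodic = periodic-L ; injective = window-injective }

        L∣n : L ∣ n
        L∣n = IsCycle.return⇒∣ (IsCycle.shift cycle i) (trans (cong S (+-comm n i)) (periodic i))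

        induced : InducedCycle S L
        induced = record { 4≤length = s≤s (s≤s (s≤s (s≤s z≤n))) ; cycle = cycle ; chordless = chordless }

      induced-cycle : Σ ℕ λ L → L ∣ n × InducedCycle S L
      induced-cycle with minimal-witness return? return-after-period
      ... | d , (i , i<n , closes) , minimal with m≤n⇒∃[o]m+o≡n (no-short-return closes)
      ...   | s , refl = 4 + s , FirstReturn.L∣n s i i<n closes minimal , FirstReturn.induced s i i<n closes minimal

    module LadderProperties {n} .{{_ : NonZero n}} (L : Ladder n) where
      open Ladder L

      x≁B : ∀ k → ¬ x ~ B k
      x≁B k x~B = noK4 (K4-from-edges (x~A k) (x~A (suc k)) x~B (A~A k) (A~B k) (A⁺~B k))

      y≁A⁺ : ∀ k → ¬ y ~ A (suc k)
      y≁A⁺ k y~A = noK4 (K4-from-edges (y~B k) (y~B (suc k)) y~A (B~B k) (~-sym (A⁺~B k)) (~-sym (A~B (suc k))))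

      A-no-backtrack : ∀ k → A (2 + k) ≢ A k
      A-no-backtrack k e =
        noK4 (K4-from-edges (A~A k) (A~B k) (subst (_~ B (suc k)) e (A⁺~B (suc k)))
                            (A⁺~B k) (A~B (suc k)) (B~B k))

      A≢B : ∀ k j → A k ≢ B j
      A≢B k j e = x≁B j (subst (x ~_) e (x~A k))

      x≢B : ∀ k → x ≢ B k
      x≢B k e = x≁B (suc k) (subst (_~ B (suc k)) (sym e) (B~B k))

      y≢A : ∀ k → y ≢ A k
      y≢A k e = y≁A⁺ k (subst (_~ A (suc k)) (sym e) (A~A k))

      x≢y : x ≢ y
      x≢y e = x≁B 0 (subst (_~ B 0) (sym e) (y~B 0))

      wrap : ∀ r → suc (r + pred n) ≡ r + n
      wrap r = trans (sym (+-suc r (pred n))) (cong (r +_) (suc-pred n))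

      A-before : ∀ r → A (suc (r + pred n)) ≡ A r
      A-before r = trans (cong A (wrap r)) (A-periodic r)

      B-before : ∀ r → B (suc (r + pred n)) ≡ B r
      B-before r = trans (cong B (wrap r)) (B-periodic r)

      y≁A : ∀ k → ¬ y ~ A k
      y≁A k y~A = y≁A⁺ (k + pred n) (subst (y ~_) (sym (A-before k)) y~A)

      B-side : Pred V 0ℓ
      B-side = ｛ y ｝ ∪ Arc B 0 n

      B-side? : Decidable B-side
      B-side? = (y Fin.≟_) ∪? arc? B 0 n

      x∉B-side : ¬ B-side x
      x∉B-side (inj₁ y≡x) = x≢y (sym y≡x)
      x∉B-side (inj₂ (j , _ , Bj≡x)) = x≢B j (sym Bj≡x)

      A∉B-side : ∀ r → ¬ B-side (A r)
      A∉B-side r (inj₁ y≡A) = y≢A r y≡A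
      A∉B-side r (inj₂ (j , _ , Bj≡A)) = A≢B r j (sym Bj≡A)

      spoke : ∀ {u} → B-side u → y ≡ u ⊎ u ~ y
      spoke (inj₁ y≡u) = inj₁ y≡u
      spoke (inj₂ (j , _ , refl)) = inj₂ (~-sym (y~B j))

      wheel : DoubleWheel x B-side A
      wheel = record
        { Z-connected = star B-side? (inj₁ refl) spoke
        ; h∉Z = x∉B-side ; c∉Z = A∉B-side ; h~c = x~A
        ; Z~c = λ r → B r , inj₂ (arc-periodic B-periodic r) , ~-sym (A~B r)
        ; c~c = A~A }

      -- Removing w lets a vertex of B serve as an outsider of the wheel around A.
      punctured-wheel : ∀ w → y ≢ w → DoubleWheel x (B-side ∖ ｛ w ｝) A
      punctured-wheel w y≢w = record
        { Z-connected = star (λ v → B-side? v ×-dec ¬? (w Fin.≟ v)) (inj₁ refl , y≢w ∘ sym) (spoke ∘ proj₁)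
        ; h∉Z = x∉B-side ∘ proj₁ ; c∉Z = λ r → A∉B-side r ∘ proj₁ ; h~c = x~A
        ; Z~c = λ r → neighbour-avoiding w (B~B (r + pred n))
                            (inj₂ (arc-periodic B-periodic _)) (inj₂ (arc-periodic B-periodic _))
                            (~-sym (subst (_~ B (r + pred n)) (A-before r) (A⁺~B (r + pred n))))
                            (subst (_~ A r) (sym (B-before r)) (~-sym (A~B r)))
        ; c~c = A~A }

      A-cycle : Σ ℕ λ p → p ∣ n × InducedCycle A p
      A-cycle = ClosedWalk.induced-cycle wheel A-periodic A-no-backtrack

      module _ {p} (CA : InducedCycle A p) where
        open InducedCycle CA using (4≤length; cycle)
        open IsCycle cycle using (periodic; injective₀)

        module OutsiderB (j : ℕ) =
          Outsider (DoubleWheel.shift (punctured-wheel (B j) (~-irrefl (y~B j))) j) (IsCycle.shift cycle j) 4≤length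
                   (λ (_ , Bj≢Bj) → Bj≢Bj refl) (x≢B j) (λ r → A≢B (r + j) j) (A~B j) (A⁺~B j)

        A-length∣B-period : ∀ {q} → Periodic B q → p ∣ q
        A-length∣B-period {q} B-periodic′ =
          OutsiderB.consecutive-neighbours⇒∣ 0 q (B₀~A (subst (λ k → A k ~ B q) q≡q+0 (A~B q)))
                                                 (B₀~A (subst (λ k → A (suc k) ~ B q) q≡q+0 (A⁺~B q)))
          where
          q≡q+0 : q ≡ q + 0
          q≡q+0 = sym (+-identityʳ q)
          B₀~A : ∀ {k} → A k ~ B q → B 0 ~ A k
          B₀~A A~Bq = subst (_~ _) (B-periodic′ 0) (~-sym A~Bq)

        x≁y : ¬ x ~ y
        x≁y x~y with m≤n⇒∃[o]m+o≡n 4≤length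
        ... | o , refl = noK5 (DoubleWheel.joined-hubs⇒K5Minor wheel (1 + o) injective₀ closing
                                                             x (inj₁ refl) x∉B-side (λ r _ e → ~-irrefl (x~A r) (sym e))
                                                             y (inj₁ refl) x~y)
          where
          closing : A (3 + o) ~ A 0
          closing = subst (A (3 + o) ~_) (periodic 0) (A~A (3 + o))

        B-sees : ∀ j {r} → r < p → A (j + r) ~ B j → r ≡ 0 ⊎ r ≡ 1
        B-sees j r<p e = OutsiderB.neighbours j r<p (subst (λ k → B j ~ A k) (+-comm j _) (~-sym e))

        wrapped-neighbours : ∀ {i j} → i < j → j < p → A i ~ B j → i ≡ 0 × suc j ≡ p
        wrapped-neighbours {i} {j} i<j j<p Ai~Bj with m≤n⇒∃[o]m+o≡n (≤-trans (<⇒≤ j<p) (m≤n+m p i))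
        ... | o , j+o≡i+p with B-sees j (+-cancelˡ-< j o p (subst (_< j + p) (sym j+o≡i+p) (+-monoˡ-< p i<j)))
                                         (subst (_~ B j) (trans (sym (periodic i)) (cong A (sym j+o≡i+p))) Ai~Bj)
        ...   | inj₁ refl = contradiction (subst (p ≤_) (trans (sym j+o≡i+p) (+-identityʳ j)) (m≤n+m p i)) (<⇒≱ j<p)
        ...   | inj₂ refl = i≡0 , trans (+-comm 1 j) (trans j+o≡i+p (cong (_+ p) i≡0))
          where
          i≡0 : i ≡ 0
          i≡0 = n≤0⇒n≡0 (+-cancelʳ-≤ p i 0 (subst (_≤ p) (trans (+-comm 1 j) j+o≡i+p) j<p))

        cross-neighbours : ∀ {i j} → i < p → j < p → A i ~ B j → i ≡ j ⊎ i ≡ suc j ⊎ (i ≡ 0 × suc j ≡ p)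
        cross-neighbours {i} {j} i<p j<p Ai~Bj with j ≤? i
        ... | no j≰i = inj₂ (inj₂ (wrapped-neighbours (≰⇒> j≰i) j<p Ai~Bj))
        ... | yes j≤i with m≤n⇒∃[o]m+o≡n j≤i
        ...   | o , refl with B-sees j (≤-<-trans (m≤n+m o j) i<p) Ai~Bj
        ...     | inj₁ refl = inj₁ (+-identityʳ j)
        ...     | inj₂ refl = inj₂ (inj₁ (+-comm j 1))

    module InducedD {n} .{{_ : NonZero n}} (L : Ladder n) {p}
                     (CA : InducedCycle (Ladder.A L) p) (CB : InducedCycle (Ladder.B L) p) where
      open Ladder L
      open LadderProperties L
      open InducedCycle CA using () renaming (cycle to A-cycle′; chordless to A-chordless)
      open InducedCycle CB using () renaming (cycle to B-cycle′; chordless to B-chordless)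

      embed : DV p → V
      embed v₁ = x
      embed v₂ = y
      embed (a i) = A (toℕ i)
      embed (b i) = B (toℕ i)

      A-injective : ∀ {i j : Fin p} → A (toℕ i) ≡ A (toℕ j) → i ≡ j
      A-injective e = Fin.toℕ-injective (IsCycle.injective₀ A-cycle′ (Fin.toℕ<n _) (Fin.toℕ<n _) e)

      B-injective : ∀ {i j : Fin p} → B (toℕ i) ≡ B (toℕ j) → i ≡ j
      B-injective e = Fin.toℕ-injective (IsCycle.injective₀ B-cycle′ (Fin.toℕ<n _) (Fin.toℕ<n _) e)

      embed-injective : ∀ u v → embed u ≡ embed v → u ≡ v
      embed-injective v₁ v₁ _ = refl
      embed-injective v₁ v₂ e = contradiction e x≢y
      embed-injective v₁ (a _) e = contradiction e (~-irrefl (x~A _))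
      embed-injective v₁ (b _) e = contradiction e (x≢B _)
      embed-injective v₂ v₁ e = contradiction (sym e) x≢y
      embed-injective v₂ v₂ _ = refl
      embed-injective v₂ (a _) e = contradiction e (y≢A _)
      embed-injective v₂ (b _) e = contradiction e (~-irrefl (y~B _))
      embed-injective (a _) v₁ e = contradiction (sym e) (~-irrefl (x~A _))
      embed-injective (a _) v₂ e = contradiction (sym e) (y≢A _)
      embed-injective (a _) (a _) e = cong a (A-injective e)
      embed-injective (a _) (b _) e = contradiction e (A≢B _ _)
      embed-injective (b _) v₁ e = contradiction (sym e) (x≢B _)
      embed-injective (b _) v₂ e = contradiction (sym e) (~-irrefl (y~B _))
      embed-injective (b _) (a _) e = contradiction (sym e) (A≢B _ _)
      embed-injective (b _) (b _) e = cong b (B-injective e)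

      embed-edge : ∀ {u v} → DE p u v → embed u ~ embed v
      embed-edge (v₁a _) = x~A _
      embed-edge (v₂b _) = y~B _
      embed-edge (ab _) = A~B _
      embed-edge (aa i _ e) = subst (λ k → A (toℕ i) ~ A k) (sym e) (A~A _)
      embed-edge (bb i _ e) = subst (λ k → B (toℕ i) ~ B k) (sym e) (B~B _)
      embed-edge (ba i _ e) = subst (λ k → A k ~ B (toℕ i)) (sym e) (A⁺~B _)
      embed-edge (aaʷ _ _ e₀ eₚ) = subst (_~ A _) (periodic-wrap (IsCycle.periodic A-cycle′) e₀ eₚ) (~-sym (A~A _))
      embed-edge (bbʷ _ _ e₀ eₚ) = subst (_~ B _) (periodic-wrap (IsCycle.periodic B-cycle′) e₀ eₚ) (~-sym (B~B _))
      embed-edge (abʷ _ _ e₀ eₚ) = subst (_~ B _) (periodic-wrap (IsCycle.periodic A-cycle′) e₀ eₚ) (A⁺~B _)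

      A-edge : ∀ i j → A (toℕ i) ~ A (toℕ j) → DAdj p (a i) (a j)
      A-edge i j e with chordless-adjacent A-chordless (Fin.toℕ<n i) (Fin.toℕ<n j) e
      ... | inj₁ i+1≡j = inj₁ (aa i j (sym i+1≡j))
      ... | inj₂ (inj₁ j+1≡i) = inj₂ (aa j i (sym j+1≡i))
      ... | inj₂ (inj₂ (inj₁ (i≡0 , j+1≡p))) = inj₁ (aaʷ i j i≡0 j+1≡p)
      ... | inj₂ (inj₂ (inj₂ (j≡0 , i+1≡p))) = inj₂ (aaʷ j i j≡0 i+1≡p)

      B-edge : ∀ i j → B (toℕ i) ~ B (toℕ j) → DAdj p (b i) (b j)
      B-edge i j e with chordless-adjacent B-chordless (Fin.toℕ<n i) (Fin.toℕ<n j) e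
      ... | inj₁ i+1≡j = inj₁ (bb i j (sym i+1≡j))
      ... | inj₂ (inj₁ j+1≡i) = inj₂ (bb j i (sym j+1≡i))
      ... | inj₂ (inj₂ (inj₁ (i≡0 , j+1≡p))) = inj₁ (bbʷ i j i≡0 j+1≡p)
      ... | inj₂ (inj₂ (inj₂ (j≡0 , i+1≡p))) = inj₂ (bbʷ j i j≡0 i+1≡p)

      AB-edge : ∀ i j → A (toℕ i) ~ B (toℕ j) → DE p (a i) (b j)
      AB-edge i j e with cross-neighbours CA (Fin.toℕ<n i) (Fin.toℕ<n j) e
      ... | inj₁ i≡j = subst (λ k → DE p (a i) (b k)) (Fin.toℕ-injective i≡j) (ab i)
      ... | inj₂ (inj₁ i≡j+1) = ba j i i≡j+1
      ... | inj₂ (inj₂ (i≡0 , j+1≡p)) = abʷ i j i≡0 j+1≡p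

      embed-reflects : ∀ u v → embed u ~ embed v → DAdj p u v
      embed-reflects v₁ v₁ e = contradiction refl (~-irrefl e)
      embed-reflects v₁ v₂ e = contradiction e (x≁y CA)
      embed-reflects v₁ (a i) _ = inj₁ (v₁a i)
      embed-reflects v₁ (b _) e = contradiction e (x≁B _)
      embed-reflects v₂ v₁ e = contradiction (~-sym e) (x≁y CA)
      embed-reflects v₂ v₂ e = contradiction refl (~-irrefl e)
      embed-reflects v₂ (a _) e = contradiction e (y≁A _)
      embed-reflects v₂ (b i) _ = inj₁ (v₂b i)
      embed-reflects (a i) v₁ _ = inj₂ (v₁a i)
      embed-reflects (a _) v₂ e = contradiction (~-sym e) (y≁A _)
      embed-reflects (a i) (a j) e = A-edge i j e
      embed-reflects (a i) (b j) e = inj₁ (AB-edge i j e)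
      embed-reflects (b _) v₁ e = contradiction (~-sym e) (x≁B _)
      embed-reflects (b i) v₂ _ = inj₂ (v₂b i)
      embed-reflects (b i) (a j) e = inj₂ (AB-edge j i (~-sym e))
      embed-reflects (b i) (b j) e = B-edge i j e

      induced : HasInducedD p H
      induced = embed , embed-injective , λ u v → mk⇔ (embed-adjacent u v) (embed-reflects u v)
        where
        embed-adjacent : ∀ u v → DAdj p u v → embed u ~ embed v
        embed-adjacent _ _ (inj₁ e) = embed-edge e
        embed-adjacent _ _ (inj₂ e) = ~-sym (embed-edge e)

    ladder⇒induced-D : ∀ {n} .{{_ : NonZero n}} → Ladder n → Σ ℕ λ m → 4 ≤ m × m ∣ n × HasInducedD m H
    ladder⇒induced-D L with LadderProperties.A-cycle L | LadderProperties.A-cycle (Ladder.swap L)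
    ... | p , p∣n , CA | q , _ , CB
      with ∣-antisym (LadderProperties.A-length∣B-period L CA (IsCycle.periodic (InducedCycle.cycle CB)))
                     (LadderProperties.A-length∣B-period (Ladder.swap L) CB (IsCycle.periodic (InducedCycle.cycle CA) ∘ suc))
    ...   | refl = p , InducedCycle.4≤length CA , p∣n , InducedD.induced L CA CB

proposition5p4 : (n : ℕ) → 4 ≤ n → (H : Graph) → ¬ HasK4 H → ¬ HasK5Minor H →
    (f : DV n → Fin (N H)) → IsHom n H f →
    Σ ℕ λ m → 4 ≤ m × m ∣ n × HasInducedD m H
proposition5p4 n@(suc _) _ H noK4 noK5 f hom = ladder⇒induced-D H noK4 noK5 (hom⇒ladder H n f hom)
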